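{- If $G$ is a well-covered graph with ${\rm diam}(G)=2$, then $\Gamma_{\rho}(G)=\chi_{\rho}(G)$.
   Context: A graph is well-covered if all its maximal independent sets have the same cardinality. $d(u,v)$ is graph distance. A packing $k$-coloring is a map $c:V(G)\to\{1,\dots,k\}$ such that $c(u)=c(v)=i$, $u\ne v$, implies $d(u,v)>i$; $\chi_{\rho}(G)$ is the smallest $k$ for which a packing $k$-coloring exists. The Grundy packing chromatic number $\Gamma_{\rho}(G)$ is the maximum number of colors $k$ in a packing coloring $c:V(G)\to\{1,\dots,k\}$ using all $k$ colors in which every vertex $v$ with $c(v)=i$ has, for every $j\in\{1,\dots,i-1\}$, a vertex $u$ with $c(u)=j$ and $d(u,v)\le j$ (equivalently, the maximum number of colors produced by the greedy procedure that processes vertices in some order and assigns each vertex the smallest color $i$ with no already-colored vertex of color $i$ at distance at most $i$). -}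

module Defs where

open import Data.Nat using (ℕ; zero; suc; _≤_; _<_)
open import Data.Fin using (Fin; toℕ)
open import Data.Fin.Subset using (Subset; _∈_; _∉_; ∣_∣)
open import Data.Product using (Σ; ∃; ∃-syntax; _×_)
open import Relation.Nullary using (¬_)
open import Relation.Binary.PropositionalEquality using (_≡_; _≢_)
open import Function using (Surjective)

record Graph : Set₁ where
  field
    n      : ℕ
    Adj    : Fin n → Fin n → Set
    sym    : ∀ {u v} → Adj u v → Adj v u
    irrefl : ∀ {u} → ¬ Adj u u

module _ (G : Graph) where
  open Graph G

  data DistLe : ℕ → Fin n → Fin n → Set where
    here : ∀ {k u} → DistLe k u u
    step : ∀ {k u w v} → Adj u w → DistLe k w v → DistLe (suc k) u v

  Diam2 : Set
  Diam2 = (∀ u v → DistLe 2 u v) × (∃[ u ] ∃[ v ] ¬ DistLe 1 u v)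

  Independent : Subset n → Set
  Independent S = ∀ u v → u ∈ S → v ∈ S → ¬ Adj u v

  MaximalIndependent : Subset n → Set
  MaximalIndependent S =
    Independent S × (∀ T → Independent T → (∀ v → v ∈ S → v ∈ T) → ∀ v → v ∈ T → v ∈ S)

  WellCovered : Set
  WellCovered = ∀ S T → MaximalIndependent S → MaximalIndependent T → ∣ S ∣ ≡ ∣ T ∣

  -- Colours 1..k are represented by Fin k; the element i : Fin k is colour toℕ i + 1.
  -- Packing condition: c(u) = c(v) = i, u ≠ v  ⇒  d(u,v) > i.
  IsPacking : (k : ℕ) → (Fin n → Fin k) → Set
  IsPacking k c = ∀ u v → u ≢ v → c u ≡ c v → ¬ DistLe (suc (toℕ (c u))) u v

  PackingColorable : ℕ → Set
  PackingColorable k = Σ (Fin n → Fin k) (IsPacking k)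

  IsPackingChromaticNumber : ℕ → Set
  IsPackingChromaticNumber k = PackingColorable k × (∀ m → m < k → ¬ PackingColorable m)

  IsGrundyPacking : (k : ℕ) → (Fin n → Fin k) → Set
  IsGrundyPacking k c =
    IsPacking k c × Surjective _≡_ _≡_ c ×
    (∀ v (j : Fin k) → toℕ j < toℕ (c v) → ∃[ u ] (c u ≡ j × DistLe (suc (toℕ j)) u v))

  HasGrundyPacking : ℕ → Set
  HasGrundyPacking k = Σ (Fin n → Fin k) (IsGrundyPacking k)

  IsGrundyPackingNumber : ℕ → Set
  IsGrundyPackingNumber k = HasGrundyPacking k × (∀ m → HasGrundyPacking m → m ≤ k)

-- In a graph of diameter 2 a packing colouring uses every colour other than 1 at most
-- once, so if its colour-1 class is I it has at least 1 + (n - |I|) colours, while a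
-- Grundy packing colouring, using all of its colours, has at most that many. The
-- colour-1 class of a packing colouring is independent and that of a Grundy packing
-- colouring is maximal independent; in a well-covered graph the former is therefore no
-- larger than the latter, which gives Γ_ρ ≤ χ_ρ.
module Submission where

open import Defs
open import Data.Nat using (ℕ; suc; zero; _≤_; _<_; _∸_; z≤n; s≤s; _≟_; _≤?_)
open import Data.Bool.Properties using (T-≡)
open import Data.Fin using (Fin; zero; suc; toℕ; punchOut)
open import Data.Fin.Properties
  using (punchOut-injective; any?; suc-injective; toℕ-injective; injective⇒≤; 0≢1+n)
  renaming (_≟_ to _≟ᶠ_)
open import Data.Fin.Subset using (Subset; inside; outside; _∈_; _⊆_; ∁; _∪_; ⁅_⁆; ∣_∣)
open import Data.Fin.Subset.Properties
  using (_∈?_; x∈p∪q⁻; x∈⁅y⁆⇒x≡y; x∈⁅x⁆; p⊆p∪q; q⊆p∪q; x∈∁p⇒x∉p; x∉p⇒x∈∁p; ∣∁p∣≡n∸∣p∣; p⊆q⇒∣p∣≤∣q∣)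
open import Data.List using (List; []; _∷_; allFin)
open import Data.List.Membership.Propositional using () renaming (_∈_ to _∈ˡ_)
open import Data.List.Membership.Propositional.Properties using (∈-allFin)
open import Data.List.Relation.Unary.Any using (here; there)
open import Data.Nat.Properties
  using (≤-antisym; ≤-trans; ≤-reflexive; ≮⇒≥; n≢0⇒n>0; 1+n≢0; ∸-monoʳ-≤; module ≤-Reasoning)
open import Data.Product using (∃-syntax; _×_; _,_; proj₁; proj₂)
open import Data.Sum using (_⊎_; inj₁; inj₂)
open import Data.Vec using (_∷_; tabulate; here; there)
open import Data.Vec.Properties using (lookup∘tabulate; []=⇒lookup; lookup⇒[]=)
open import Function using (id; _∘_; Injective; Equivalence)
open import Relation.Binary.PropositionalEquality using (_≡_; _≢_; refl; sym; trans; cong; subst; module ≡-Reasoning)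
open import Relation.Nullary using (¬_; Dec; yes; no; ⌊_⌋; contradiction)
open import Relation.Nullary.Decidable using (toWitness; fromWitness; decidable-stable; ¬¬-excluded-middle; _×-dec_)
open import Relation.Unary using (Pred; Decidable)

private
  variable
    n m : ℕ

module _ {p} {P : Pred (Fin n) p} where

  select : Decidable P → Subset n
  select P? = tabulate (⌊_⌋ ∘ P?)

  ∈-select⁺ : (P? : Decidable P) {v : Fin n} → P v → v ∈ select P?
  ∈-select⁺ P? {v} Pv =
    lookup⇒[]= v _ (trans (lookup∘tabulate _ v) (Equivalence.to T-≡ (fromWitness {a? = P? v} Pv)))

  ∈-select⁻ : (P? : Decidable P) {v : Fin n} → v ∈ select P? → P v
  ∈-select⁻ P? {v} v∈ =
    toWitness {a? = P? v} (Equivalence.from T-≡ (trans (sym (lookup∘tabulate (⌊_⌋ ∘ P?) v)) ([]=⇒lookup v∈)))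

element : (p : Subset n) → Fin ∣ p ∣ → Fin n
element (outside ∷ p) i       = suc (element p i)
element (inside  ∷ p) zero    = zero
element (inside  ∷ p) (suc i) = suc (element p i)

element-∈ : (p : Subset n) (i : Fin ∣ p ∣) → element p i ∈ p
element-∈ (outside ∷ p) i       = there (element-∈ p i)
element-∈ (inside  ∷ p) zero    = here
element-∈ (inside  ∷ p) (suc i) = there (element-∈ p i)

element-injective : (p : Subset n) → Injective _≡_ _≡_ (element p)
element-injective (outside ∷ p) eq = element-injective p (suc-injective eq)
element-injective (inside  ∷ p) {zero}  {zero}  eq = refl
element-injective (inside  ∷ p) {suc i} {suc j} eq = cong suc (element-injective p (suc-injective eq))

index : (p : Subset n) {v : Fin n} → v ∈ p → Fin ∣ p ∣
index (inside  ∷ p) here        = zero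
index (inside  ∷ p) (there v∈p) = suc (index p v∈p)
index (outside ∷ p) (there v∈p) = index p v∈p

element-index : (p : Subset n) {v : Fin n} (v∈p : v ∈ p) → element p (index p v∈p) ≡ v
element-index (inside  ∷ p) here        = refl
element-index (inside  ∷ p) (there v∈p) = cong suc (element-index p v∈p)
element-index (outside ∷ p) (there v∈p) = cong suc (element-index p v∈p)

injective-into⇒≤∣p∣ : (p : Subset n) (f : Fin m → Fin n) →
  (∀ i → f i ∈ p) → Injective _≡_ _≡_ f → m ≤ ∣ p ∣
injective-into⇒≤∣p∣ p f f∈p f-inj = injective⇒≤ {f = index p ∘ f∈p} λ {i} {j} eq → f-inj (begin
  f i                            ≡⟨ sym (element-index p (f∈p i)) ⟩
  element p (index p (f∈p i))    ≡⟨ cong (element p) eq ⟩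
  element p (index p (f∈p j))    ≡⟨ element-index p (f∈p j) ⟩
  f j                            ∎)
  where open ≡-Reasoning

injective-from⇒∣p∣≤ : (p : Subset n) (h : ∀ v → v ∈ p → Fin m) →
  (∀ {u v} u∈p v∈p → h u u∈p ≡ h v v∈p → u ≡ v) → ∣ p ∣ ≤ m
injective-from⇒∣p∣≤ p h h-inj =
  injective⇒≤ {f = λ i → h (element p i) (element-∈ p i)}
    (element-injective p ∘ h-inj (element-∈ p _) (element-∈ p _))

¬¬-∀-Fin : ∀ {ℓ} {P : Fin n → Set ℓ} → (∀ i → ¬ ¬ P i) → ¬ ¬ (∀ i → P i)
¬¬-∀-Fin {zero}  ¬¬P ¬∀P = ¬∀P λ ()
¬¬-∀-Fin {suc n} ¬¬P ¬∀P =
  ¬¬P zero λ P0 → ¬¬-∀-Fin (¬¬P ∘ suc) λ P+ → ¬∀P λ { zero → P0 ; (suc i) → P+ i }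

module _ (G : Graph) where
  open Graph G using (Adj; irrefl) renaming (n to order; sym to Adj-sym)

  DistLe-mono : ∀ {k l u v} → k ≤ l → DistLe G k u v → DistLe G l u v
  DistLe-mono _         here       = here
  DistLe-mono (s≤s k≤l) (step a d) = step a (DistLe-mono k≤l d)

  DistLe-1⇒≡⊎Adj : ∀ {u v} → DistLe G 1 u v → u ≡ v ⊎ Adj u v
  DistLe-1⇒≡⊎Adj here          = inj₁ refl
  DistLe-1⇒≡⊎Adj (step a here) = inj₂ a

  module MaximalExtension (Adj? : ∀ u v → Dec (Adj u v)) where

    HasNeighbourIn : Subset order → Fin order → Set
    HasNeighbourIn S v = ∃[ u ] (u ∈ S × Adj u v)

    hasNeighbourIn? : ∀ S v → Dec (HasNeighbourIn S v)
    hasNeighbourIn? S v = any? (λ u → (u ∈? S) ×-dec Adj? u v)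

    Dominates : Subset order → Fin order → Set
    Dominates S v = v ∈ S ⊎ HasNeighbourIn S v

    Dominates-mono : ∀ {S T} → S ⊆ T → ∀ {v} → Dominates S v → Dominates T v
    Dominates-mono S⊆T (inj₁ v∈S)             = inj₁ (S⊆T v∈S)
    Dominates-mono S⊆T (inj₂ (u , u∈S , adj)) = inj₂ (u , S⊆T u∈S , adj)

    addIfFree : ∀ S v → Dec (HasNeighbourIn S v) → Subset order
    addIfFree S v (yes _) = S
    addIfFree S v (no _)  = S ∪ ⁅ v ⁆

    addIfFree-independent : ∀ S v d → Independent G S → Independent G (addIfFree S v d)
    addIfFree-independent S v (yes _) S-indep = S-indep
    addIfFree-independent S v (no free) S-indep x y x∈ y∈ adj
      with x∈p∪q⁻ S ⁅ v ⁆ x∈ | x∈p∪q⁻ S ⁅ v ⁆ y∈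
    ... | inj₁ x∈S | inj₁ y∈S = S-indep x y x∈S y∈S adj
    ... | inj₁ x∈S | inj₂ y≡v = free (x , x∈S , subst (Adj x) (x∈⁅y⁆⇒x≡y v y≡v) adj)
    ... | inj₂ x≡v | inj₁ y∈S = free (y , y∈S , subst (Adj y) (x∈⁅y⁆⇒x≡y v x≡v) (Adj-sym adj))
    ... | inj₂ x≡v | inj₂ y≡v =
      irrefl (subst (Adj x) (trans (x∈⁅y⁆⇒x≡y v y≡v) (sym (x∈⁅y⁆⇒x≡y v x≡v))) adj)

    ⊆-addIfFree : ∀ S v d → S ⊆ addIfFree S v d
    ⊆-addIfFree S v (yes _) = id
    ⊆-addIfFree S v (no _)  = p⊆p∪q ⁅ v ⁆

    addIfFree-dominates : ∀ S v d → Dominates (addIfFree S v d) v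
    addIfFree-dominates S v (yes nb) = inj₂ nb
    addIfFree-dominates S v (no _)   = inj₁ (q⊆p∪q S ⁅ v ⁆ (x∈⁅x⁆ v))

    greedy : List (Fin order) → Subset order → Subset order
    greedy []       S = S
    greedy (v ∷ vs) S = greedy vs (addIfFree S v (hasNeighbourIn? S v))

    greedy-independent : ∀ vs S → Independent G S → Independent G (greedy vs S)
    greedy-independent []       S S-indep = S-indep
    greedy-independent (v ∷ vs) S S-indep =
      greedy-independent vs _ (addIfFree-independent S v (hasNeighbourIn? S v) S-indep)

    ⊆-greedy : ∀ vs S → S ⊆ greedy vs S
    ⊆-greedy []       S = id
    ⊆-greedy (v ∷ vs) S = ⊆-greedy vs _ ∘ ⊆-addIfFree S v (hasNeighbourIn? S v)

    greedy-dominates : ∀ vs S {v} → v ∈ˡ vs → Dominates (greedy vs S) v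
    greedy-dominates (v ∷ vs) S (here refl) =
      Dominates-mono (⊆-greedy vs _) (addIfFree-dominates S v (hasNeighbourIn? S v))
    greedy-dominates (w ∷ vs) S (there v∈vs) = greedy-dominates vs _ v∈vs

    extend-maximal : ∀ S → Independent G S → ∃[ T ] (MaximalIndependent G T × S ⊆ T)
    extend-maximal S S-indep = T , (greedy-independent vs S S-indep , maximal) , ⊆-greedy vs S
      where
      vs : List (Fin order)
      vs = allFin order
      T : Subset order
      T = greedy vs S
      maximal : ∀ T′ → Independent G T′ → (∀ v → v ∈ T → v ∈ T′) → ∀ v → v ∈ T′ → v ∈ T
      maximal T′ T′-indep T⊆T′ v v∈T′ with greedy-dominates vs S (∈-allFin v)
      ... | inj₁ v∈T               = v∈T
      ... | inj₂ (u , u∈T , adj)   = contradiction adj (T′-indep u v (T⊆T′ u u∈T) v∈T′)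

  ¬¬-Adj-decidable : ¬ ¬ (∀ u v → Dec (Adj u v))
  ¬¬-Adj-decidable = ¬¬-∀-Fin λ u → ¬¬-∀-Fin λ v → ¬¬-excluded-middle

  -- Adj is not assumed decidable, but the conclusion is, so we may decide Adj under ¬¬.
  WellCovered⇒∣independent∣≤∣maximal∣ : WellCovered G → ∀ {S T} →
    Independent G S → MaximalIndependent G T → ∣ S ∣ ≤ ∣ T ∣
  WellCovered⇒∣independent∣≤∣maximal∣ well-covered {S} {T} S-indep T-max =
    decidable-stable (∣ S ∣ ≤? ∣ T ∣) λ S≰T → ¬¬-Adj-decidable λ Adj? →
      let (T′ , T′-max , S⊆T′) = MaximalExtension.extend-maximal Adj? S S-indep
      in S≰T (≤-trans (p⊆q⇒∣p∣≤∣q∣ S⊆T′) (≤-reflexive (well-covered T′ T T′-max T-max)))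

  firstClass : ∀ {k} → (Fin order → Fin k) → Subset order
  firstClass c = select (λ v → toℕ (c v) ≟ 0)

  module _ {k} {c : Fin order → Fin k} {v : Fin order} where

    ∈-firstClass⁺ : toℕ (c v) ≡ 0 → v ∈ firstClass c
    ∈-firstClass⁺ = ∈-select⁺ (λ v → toℕ (c v) ≟ 0)

    ∈-firstClass⁻ : v ∈ firstClass c → toℕ (c v) ≡ 0
    ∈-firstClass⁻ = ∈-select⁻ (λ v → toℕ (c v) ≟ 0)

    ∈-∁-firstClass⁺ : toℕ (c v) ≢ 0 → v ∈ ∁ (firstClass c)
    ∈-∁-firstClass⁺ cv≢0 = x∉p⇒x∈∁p (cv≢0 ∘ ∈-firstClass⁻)

    ∈-∁-firstClass⁻ : v ∈ ∁ (firstClass c) → toℕ (c v) ≢ 0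
    ∈-∁-firstClass⁻ v∈ = x∈∁p⇒x∉p v∈ ∘ ∈-firstClass⁺

  firstClass-independent : ∀ {k c} → IsPacking G k c → Independent G (firstClass c)
  firstClass-independent {c = c} packing u v u∈ v∈ adj =
    packing u v u≢v (toℕ-injective (trans cu≡0 (sym cv≡0)))
      (subst (λ d → DistLe G (suc d) u v) (sym cu≡0) (step adj here))
    where
    cu≡0 : toℕ (c u) ≡ 0
    cu≡0 = ∈-firstClass⁻ u∈
    cv≡0 : toℕ (c v) ≡ 0
    cv≡0 = ∈-firstClass⁻ v∈
    u≢v : u ≢ v
    u≢v refl = irrefl adj

  grundy-firstClass-dominating : ∀ {k c} → IsGrundyPacking G k c →
    ∀ v → toℕ (c v) ≢ 0 → ∃[ u ] (u ∈ firstClass c × Adj u v)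
  grundy-firstClass-dominating {c = c} (_ , _ , grundy) v cv≢0 = dominate (c v) refl cv≢0
    where
    dominate : ∀ x → c v ≡ x → toℕ x ≢ 0 → ∃[ u ] (u ∈ firstClass c × Adj u v)
    dominate zero    _    0≢0 = contradiction refl 0≢0
    dominate (suc x) cv≡x _
      with grundy v zero (subst (λ y → 0 < toℕ y) (sym cv≡x) (s≤s z≤n))
    ... | u , cu≡0 , u~v with DistLe-1⇒≡⊎Adj u~v
    ...   | inj₁ refl = contradiction (trans (sym cu≡0) cv≡x) 0≢1+n
    ...   | inj₂ adj  = u , ∈-firstClass⁺ (cong toℕ cu≡0) , adj

  grundy-firstClass-maximal : ∀ {k c} → IsGrundyPacking G k c → MaximalIndependent G (firstClass c)
  grundy-firstClass-maximal {c = c} g@(packing , _ , _) = firstClass-independent packing , maximal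
    where
    maximal : ∀ T → Independent G T → (∀ v → v ∈ firstClass c → v ∈ T) →
      ∀ v → v ∈ T → v ∈ firstClass c
    maximal T T-indep I⊆T v v∈T with toℕ (c v) ≟ 0
    ... | yes cv≡0 = ∈-firstClass⁺ cv≡0
    ... | no cv≢0  =
      let (u , u∈I , adj) = grundy-firstClass-dominating g v cv≢0
      in contradiction adj (T-indep u v (I⊆T u u∈I) v∈T)

  module _ (diam≤2 : ∀ u v → DistLe G 2 u v) where

    packing-unique-beyond-first : ∀ {k c} → IsPacking G k c →
      ∀ {u v} → toℕ (c u) ≢ 0 → c u ≡ c v → u ≡ v
    packing-unique-beyond-first packing {u} {v} cu≢0 cu≡cv with u ≟ᶠ v
    ... | yes u≡v = u≡v
    ... | no  u≢v =
      contradiction (DistLe-mono (s≤s (n≢0⇒n>0 cu≢0)) (diam≤2 u v)) (packing u v u≢v cu≡cv)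

    packing-colours≥ : ∀ {k c} → IsPacking G k c → Fin order → suc ∣ ∁ (firstClass c) ∣ ≤ k
    packing-colours≥ {zero}  {c} _ a with c a
    ... | ()
    packing-colours≥ {suc k} {c} packing _ =
      s≤s (injective-from⇒∣p∣≤ (∁ (firstClass c)) shift shift-injective)
      where
      0≢c : ∀ {v} → v ∈ ∁ (firstClass c) → zero ≢ c v
      0≢c v∈ 0≡cv = ∈-∁-firstClass⁻ v∈ (cong toℕ (sym 0≡cv))
      shift : ∀ v → v ∈ ∁ (firstClass c) → Fin k
      shift v v∈ = punchOut (0≢c v∈)
      shift-injective : ∀ {u v} u∈ v∈ → shift u u∈ ≡ shift v v∈ → u ≡ v
      shift-injective u∈ v∈ eq = packing-unique-beyond-first packing (∈-∁-firstClass⁻ u∈)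
        (punchOut-injective (0≢c u∈) (0≢c v∈) eq)

  grundy-colours≤ : ∀ {k c} → IsGrundyPacking G k c → k ≤ suc ∣ ∁ (firstClass c) ∣
  grundy-colours≤ {zero}      _                  = z≤n
  grundy-colours≤ {suc k} {c} (_ , surjective , _) =
    s≤s (injective-into⇒≤∣p∣ (∁ (firstClass c)) f f∈ f-injective)
    where
    f : Fin k → Fin order
    f j = proj₁ (surjective (suc j))
    c∘f : ∀ j → c (f j) ≡ suc j
    c∘f j = proj₂ (surjective (suc j)) refl
    f∈ : ∀ j → f j ∈ ∁ (firstClass c)
    f∈ j = ∈-∁-firstClass⁺ λ cfj≡0 → 1+n≢0 (trans (sym (cong toℕ (c∘f j))) cfj≡0)
    f-injective : Injective _≡_ _≡_ f
    f-injective {i} {j} eq = suc-injective (trans (sym (c∘f i)) (trans (cong c eq) (c∘f j)))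

corollary18 : (G : Graph) → WellCovered G → Diam2 G →
    ∀ (χ Γ : ℕ) → IsPackingChromaticNumber G χ → IsGrundyPackingNumber G Γ → Γ ≡ χ
corollary18 G well-covered (diam≤2 , a , _) χ Γ ((c , c-packing) , χ-minimal) ((g , g-grundy) , _) =
  ≤-antisym Γ≤χ χ≤Γ
  where
  open Graph G using () renaming (n to order)
  I J : Subset order
  I = firstClass G c
  J = firstClass G g
  ∣I∣≤∣J∣ : ∣ I ∣ ≤ ∣ J ∣
  ∣I∣≤∣J∣ = WellCovered⇒∣independent∣≤∣maximal∣ G well-covered
    (firstClass-independent G c-packing) (grundy-firstClass-maximal G g-grundy)
  χ≤Γ : χ ≤ Γ
  χ≤Γ = ≮⇒≥ λ Γ<χ → χ-minimal Γ Γ<χ (g , proj₁ g-grundy)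
  Γ≤χ : Γ ≤ χ
  Γ≤χ = begin
    Γ                    ≤⟨ grundy-colours≤ G g-grundy ⟩
    suc ∣ ∁ J ∣          ≡⟨ cong suc (∣∁p∣≡n∸∣p∣ J) ⟩
    suc (order ∸ ∣ J ∣)  ≤⟨ s≤s (∸-monoʳ-≤ order ∣I∣≤∣J∣) ⟩
    suc (order ∸ ∣ I ∣)  ≡⟨ cong suc (∣∁p∣≡n∸∣p∣ I) ⟨
    suc ∣ ∁ I ∣          ≤⟨ packing-colours≥ G diam≤2 c-packing a ⟩
    χ                    ∎
    where open ≤-Reasoning
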